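{- Let $G$ be a very well-covered graph and let $S$ be a stable set of $G$. Then $S\in\Psi(G)$ if and only if $|S|=|N(S)|$.
   Context: All graphs are finite, simple (undirected, loopless, no multiple edges). For $A\subseteq V(G)$, $N(A)=\{v\in V(G)-A: N(v)\cap A\neq\emptyset\}$ and $N[A]=A\cup N(A)$; $G[X]$ is the subgraph induced by $X$. $\alpha(G)$ is the maximum size of a stable (independent) set. A graph is well-covered if all its maximal stable sets have the same cardinality; it is very well-covered if it is well-covered, has no isolated vertices, and $|V(G)|=2\alpha(G)$. A set $S\subseteq V(G)$ is a local maximum stable set of $G$ if $S$ is a maximum stable set of the induced subgraph $G[N[S]]$; $\Psi(G)$ denotes the family of all local maximum stable sets of $G$. -}

module Defs where

open import Data.Nat using (ℕ; _≤_; _*_)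
open import Data.Fin using (Fin)
open import Data.Fin.Subset using (Subset; _∈_; _∉_; _⊆_; ∣_∣; _∪_; inside; outside)
open import Data.Vec using (tabulate)
open import Data.Fin.Properties using (any?)
open import Data.Product using (Σ; _×_; ∃)
open import Relation.Nullary using (¬_; Dec; yes; no)
open import Relation.Nullary.Decidable using (_×-dec_)
open import Relation.Binary.PropositionalEquality using (_≡_)
open import Data.Fin.Subset.Properties using (_∈?_)

record Graph (n : ℕ) : Set₁ where
  field
    Adj     : Fin n → Fin n → Set
    adj?    : (x y : Fin n) → Dec (Adj x y)
    sym     : ∀ {x y} → Adj x y → Adj y x
    irrefl  : ∀ {x} → ¬ Adj x x

module _ {n : ℕ} (G : Graph n) where
  open Graph G

  Stable : Subset n → Set
  Stable S = ∀ x y → x ∈ S → y ∈ S → ¬ Adj x y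

  -- N(A) = { v ∉ A : v has a neighbour in A }
  Nbhd : Subset n → Subset n
  Nbhd A = tabulate λ v → decide ((¬? (v ∈? A)) ×-dec any? (λ u → (u ∈? A) ×-dec adj? v u))
    where
      open import Relation.Nullary using (¬?)
      decide : ∀ {P : Set} → Dec P → _
      decide (yes _) = inside
      decide (no _)  = outside

  ClosedNbhd : Subset n → Subset n
  ClosedNbhd A = A ∪ Nbhd A

  MaximumStableIn : Subset n → Subset n → Set
  MaximumStableIn X S = S ⊆ X × Stable S × (∀ T → T ⊆ X → Stable T → ∣ T ∣ ≤ ∣ S ∣)

  MaximumStable : Subset n → Set
  MaximumStable S = Stable S × (∀ T → Stable T → ∣ T ∣ ≤ ∣ S ∣)

  MaximalStable : Subset n → Set
  MaximalStable S = Stable S × (∀ v → v ∉ S → ∃ λ u → u ∈ S × Adj v u)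

  WellCovered : Set
  WellCovered = ∀ S T → MaximalStable S → MaximalStable T → ∣ S ∣ ≡ ∣ T ∣

  NoIsolated : Set
  NoIsolated = ∀ v → ∃ λ u → Adj v u

  -- |V(G)| = 2 α(G): some maximum stable set S has n = 2|S|
  VeryWellCovered : Set
  VeryWellCovered = WellCovered × NoIsolated × (∃ λ S → MaximumStable S × n ≡ 2 * ∣ S ∣)

  -- S ∈ Ψ(G): S is a maximum stable set of G[N[S]]
  LocalMaximumStable : Subset n → Set
  LocalMaximumStable S = MaximumStableIn (ClosedNbhd S) S

module Submission where

-- The engine is an exchange argument valid in every well-covered graph (`augment`): given a
-- stable D outside N[A] and y ∈ N(D) − N[A], there is a stable Y ∋ y inside N(D) − N[A] with
-- |D| ≤ |Y| + |D′|, where D′ ⊆ D is the part of D with no neighbour in Y.  It is proved by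
-- comparing a stable set with a maximal stable set (`exchange`).  Two consequences follow:
--   * `hall`: a stable Q outside N[S] whose vertices have neighbours outside N[S] has at least
--     |Q| neighbours outside N[S] (induction along ⊂); with S = ∅ and no isolated vertices this
--     gives |B| ≤ |N(B)| for every stable B (`nbhd-lower-bound`);
--   * `escape`: for S ∈ Ψ(G), every non-isolated vertex outside N[S] has a neighbour outside N[S].
-- For S ∈ Ψ(G), extending S by a maximal stable set Q of G − N[S] yields a maximum stable set,
-- of size n/2; counting S ∪ Q, N(S) and N(Q) − N[S] inside V gives |N(S)| ≤ |S|
-- (`nbhd-upper-bound`).  Conversely |S| = |N(S)| bounds every stable T ⊆ N[S] by splitting it
-- along S and N(S) (`balanced⇒local-max`).

open import Defs
open import Data.Nat using (ℕ; zero; suc; _+_; _*_; _≤_; _<_; z≤n)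
open import Data.Nat.Properties
open import Data.Fin using (Fin)
open import Data.Fin.Subset
open import Data.Fin.Subset.Properties
open import Data.Fin.Subset.Induction using (⊂-wellFounded; Acc; acc)
open import Data.Fin.Properties using (any?)
open import Data.Vec using (_∷_; []; lookup; tabulate)
open import Data.Vec.Properties using (lookup∘tabulate; []=⇒lookup; lookup⇒[]=)
open import Data.Product using (_×_; _,_; ∃; proj₁; proj₂; uncurry)
open import Data.Sum using (_⊎_; inj₁; inj₂; [_,_]; [_,_]′)
open import Data.Empty using (⊥-elim)
open import Function using (_∘_; _∋_)
open import Function.Bundles using (_⇔_; mk⇔; Equivalence)
open import Relation.Nullary using (¬_; yes; no; does; ¬?; contradiction)
open import Relation.Nullary.Decidable using (_×-dec_; dec-true; decidable-stable; toSum)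
open import Relation.Unary using (Decidable)
open import Relation.Binary.PropositionalEquality using (_≡_; refl; sym; trans; cong; subst; module ≡-Reasoning)

private variable
  n : ℕ

module _ {P : Fin n → Set} (P? : Decidable P) where

  ∈-decided : {p : Subset n} → (∀ x → lookup p x ≡ does (P? x)) → ∀ {x} → x ∈ p ⇔ P x
  ∈-decided {p} bits {x} = mk⇔ to from
    where
      to : x ∈ p → P x
      to x∈p with P? x | trans (sym (bits x)) ([]=⇒lookup x∈p)
      ... | yes px | _ = px
      from : P x → x ∈ p
      from px = lookup⇒[]= x p (trans (bits x) (dec-true (P? x) px))

module _ {P : Fin n → Set} where

  abstract
    ⟦_⟧ : Decidable P → Subset n
    ⟦ P? ⟧ = tabulate (does ∘ P?)

    ∈⟦⟧⁺ : {P? : Decidable P} {x : Fin n} → P x → x ∈ ⟦ P? ⟧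
    ∈⟦⟧⁺ {P?} = Equivalence.from (∈-decided P? (lookup∘tabulate _))

    ∈⟦⟧⁻ : {P? : Decidable P} {x : Fin n} → x ∈ ⟦ P? ⟧ → P x
    ∈⟦⟧⁻ {P?} = Equivalence.to (∈-decided P? (lookup∘tabulate _))

∣p∪q∣+∣p∩q∣ : (p q : Subset n) → ∣ p ∪ q ∣ + ∣ p ∩ q ∣ ≡ ∣ p ∣ + ∣ q ∣
∣p∪q∣+∣p∩q∣ []            []            = refl
∣p∪q∣+∣p∩q∣ (outside ∷ p) (outside ∷ q) = ∣p∪q∣+∣p∩q∣ p q
∣p∪q∣+∣p∩q∣ (outside ∷ p) (inside  ∷ q) = trans (cong suc (∣p∪q∣+∣p∩q∣ p q)) (sym (+-suc ∣ p ∣ ∣ q ∣))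
∣p∪q∣+∣p∩q∣ (inside  ∷ p) (outside ∷ q) = cong suc (∣p∪q∣+∣p∩q∣ p q)
∣p∪q∣+∣p∩q∣ (inside  ∷ p) (inside  ∷ q) = begin
  suc (∣ p ∪ q ∣ + suc ∣ p ∩ q ∣) ≡⟨ cong suc (+-suc ∣ p ∪ q ∣ ∣ p ∩ q ∣) ⟩
  suc (suc (∣ p ∪ q ∣ + ∣ p ∩ q ∣)) ≡⟨ cong (suc ∘ suc) (∣p∪q∣+∣p∩q∣ p q) ⟩
  suc (suc (∣ p ∣ + ∣ q ∣))       ≡⟨ cong suc (sym (+-suc ∣ p ∣ ∣ q ∣)) ⟩
  suc (∣ p ∣ + suc ∣ q ∣)         ∎
  where open ≡-Reasoning

∣p∪q∣≤∣p∣+∣q∣ : (p q : Subset n) → ∣ p ∪ q ∣ ≤ ∣ p ∣ + ∣ q ∣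
∣p∪q∣≤∣p∣+∣q∣ p q = ≤-trans (m≤m+n _ _) (≤-reflexive (∣p∪q∣+∣p∩q∣ p q))

Disjoint : Subset n → Subset n → Set
Disjoint p q = ∀ {x} → x ∈ p → x ∉ q

disjoint⇒∣p∪q∣≡∣p∣+∣q∣ : {p q : Subset n} → Disjoint p q → ∣ p ∪ q ∣ ≡ ∣ p ∣ + ∣ q ∣
disjoint⇒∣p∪q∣≡∣p∣+∣q∣ {n} {p} {q} p#q = begin
  ∣ p ∪ q ∣                ≡⟨ sym (+-identityʳ _) ⟩
  ∣ p ∪ q ∣ + 0            ≡⟨ cong (∣ p ∪ q ∣ +_) ∣p∩q∣≡0 ⟨
  ∣ p ∪ q ∣ + ∣ p ∩ q ∣    ≡⟨ ∣p∪q∣+∣p∩q∣ p q ⟩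
  ∣ p ∣ + ∣ q ∣            ∎
  where
    open ≡-Reasoning
    ∣p∩q∣≡0 : ∣ p ∩ q ∣ ≡ 0
    ∣p∩q∣≡0 = trans (cong ∣_∣ (Empty-unique λ (x , x∈p∩q) → uncurry p#q (x∈p∩q⁻ p q x∈p∩q))) (∣⊥∣≡0 n)

disjoint⇒∣p∣+∣q∣≤∣r∣ : {p q r : Subset n} → Disjoint p q → p ⊆ r → q ⊆ r → ∣ p ∣ + ∣ q ∣ ≤ ∣ r ∣
disjoint⇒∣p∣+∣q∣≤∣r∣ {p = p} {q} p#q p⊆r q⊆r =
  ≤-trans (≤-reflexive (sym (disjoint⇒∣p∪q∣≡∣p∣+∣q∣ p#q)))
          (p⊆q⇒∣p∣≤∣q∣ λ x∈p∪q → [ p⊆r , q⊆r ] (x∈p∪q⁻ p q x∈p∪q))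

half-bound : {p s q m o : ℕ} → p + (m + o) ≤ 2 * p → p ≤ s + q → q ≤ o → m ≤ s
half-bound {p} {s} {q} {m} {o} total p≤s+q q≤o = +-cancelʳ-≤ o m s (begin
  m + o    ≤⟨ +-cancelˡ-≤ p _ _ (≤-trans total (≤-reflexive (cong (p +_) (+-identityʳ p)))) ⟩
  p        ≤⟨ p≤s+q ⟩
  s + q    ≤⟨ +-monoʳ-≤ s q≤o ⟩
  s + o    ∎)
  where open ≤-Reasoning

module _ {n : ℕ} (G : Graph n) where
  open Graph G renaming (sym to adj-sym)

  AdjTo : Subset n → Fin n → Set
  AdjTo A v = ∃ λ u → u ∈ A × Adj v u

  adjTo? : (A : Subset n) → Decidable (AdjTo A)
  adjTo? A v = any? λ u → (u ∈? A) ×-dec adj? v u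

  adjTo-mono : {A B : Subset n} {v : Fin n} → A ⊆ B → AdjTo A v → AdjTo B v
  adjTo-mono A⊆B (u , u∈A , v~u) = u , A⊆B u∈A , v~u

  Undominated : Subset n → Fin n → Set
  Undominated A v = v ∉ A × ¬ AdjTo A v

  undominated? : (A : Subset n) → Decidable (Undominated A)
  undominated? A v = ¬? (v ∈? A) ×-dec ¬? (adjTo? A v)

  undominated-⊥ : (v : Fin n) → Undominated ⊥ v
  undominated-⊥ v = ∉⊥ , λ (_ , u∈⊥ , _) → ∉⊥ u∈⊥

  module _ {A : Subset n} where
    private
      InNbhd : Fin n → Set
      InNbhd v = v ∉ A × AdjTo A v

      inNbhd? : Decidable InNbhd
      inNbhd? v = ¬? (v ∈? A) ×-dec adjTo? A v

      -- Nbhd tabulates the decisions of InNbhd; splitting on their components evaluates a bit.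
      nbhd-bits : ∀ v → lookup (Nbhd G A) v ≡ does (inNbhd? v)
      nbhd-bits v with (lookup (Nbhd G A) v ≡ _) ∋ lookup∘tabulate _ v
      ... | e with v ∈? A | adjTo? A v
      ... | yes _ | _     = e
      ... | no _  | yes _ = e
      ... | no _  | no _  = e

    ∈Nbhd⁺ : {v : Fin n} → v ∉ A → AdjTo A v → v ∈ Nbhd G A
    ∈Nbhd⁺ v∉A v~A = Equivalence.from (∈-decided inNbhd? nbhd-bits) (v∉A , v~A)

    ∈Nbhd⁻ : {v : Fin n} → v ∈ Nbhd G A → v ∉ A × AdjTo A v
    ∈Nbhd⁻ = Equivalence.to (∈-decided inNbhd? nbhd-bits)

  -- No edge joins a vertex of A to a vertex of B; Stable G A is NoEdges A A.
  NoEdges : Subset n → Subset n → Set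
  NoEdges A B = ∀ x y → x ∈ A → y ∈ B → ¬ Adj x y

  noEdges-sym : {A B : Subset n} → NoEdges A B → NoEdges B A
  noEdges-sym A≁B x y x∈B y∈A = A≁B y x y∈A x∈B ∘ adj-sym

  noEdges-∪ˡ : {A B C : Subset n} → NoEdges A C → NoEdges B C → NoEdges (A ∪ B) C
  noEdges-∪ˡ {A} {B} A≁C B≁C x y x∈A∪B y∈C =
    [ (λ x∈A → A≁C x y x∈A y∈C) , (λ x∈B → B≁C x y x∈B y∈C) ] (x∈p∪q⁻ A B x∈A∪B)

  noEdges-∪ʳ : {A B C : Subset n} → NoEdges C A → NoEdges C B → NoEdges C (A ∪ B)
  noEdges-∪ʳ C≁A C≁B = noEdges-sym (noEdges-∪ˡ (noEdges-sym C≁A) (noEdges-sym C≁B))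

  noEdges-⊆ʳ : {A B B′ : Subset n} → B′ ⊆ B → NoEdges A B → NoEdges A B′
  noEdges-⊆ʳ B′⊆B A≁B x y x∈A y∈B′ = A≁B x y x∈A (B′⊆B y∈B′)

  stable-∪ : {A B : Subset n} → Stable G A → Stable G B → NoEdges A B → Stable G (A ∪ B)
  stable-∪ sA sB A≁B = noEdges-∪ˡ (noEdges-∪ʳ sA A≁B) (noEdges-∪ʳ (noEdges-sym A≁B) sB)

  stable-⊆ : {A B : Subset n} → A ⊆ B → Stable G B → Stable G A
  stable-⊆ A⊆B sB x y x∈A y∈A = sB x y (A⊆B x∈A) (A⊆B y∈A)

  stable-⊥ : Stable G ⊥
  stable-⊥ x y x∈⊥ = ⊥-elim (∉⊥ x∈⊥)

  stable-⁅⁆ : (v : Fin n) → Stable G ⁅ v ⁆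
  stable-⁅⁆ v x y x∈v y∈v with x∈⁅y⁆⇒x≡y v x∈v | x∈⁅y⁆⇒x≡y v y∈v
  ... | refl | refl = irrefl

  undominated-noEdges : {A B : Subset n} → (∀ {v} → v ∈ B → Undominated A v) → NoEdges A B
  undominated-noEdges B∩N[A]=∅ x y x∈A y∈B x~y = proj₂ (B∩N[A]=∅ y∈B) (x , x∈A , adj-sym x~y)

  record MaximalIn (U : Fin n → Set) (P : Subset n) : Set where
    field
      within     : ∀ {v} → v ∈ P → U v
      stable     : Stable G P
      dominating : ∀ {v} → U v → v ∉ P → AdjTo P v

  maximal-or-grow : {U : Fin n → Set} → Decidable U → (X : Subset n) → (∀ {v} → v ∈ X → U v) → Stable G X →
                    MaximalIn U X ⊎ ∃ λ X⁺ → X ⊆ X⁺ × ∣ X ∣ < ∣ X⁺ ∣ × (∀ {v} → v ∈ X⁺ → U v) × Stable G X⁺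
  maximal-or-grow {U} U? X X⊆U sX with any? (λ v → U? v ×-dec undominated? X v)
  ... | no none = inj₁ record { within = X⊆U ; stable = sX ; dominating = dominating }
    where
      dominating : ∀ {v} → U v → v ∉ X → AdjTo X v
      dominating {v} uv v∉X = decidable-stable (adjTo? X v) λ v≁X → none (v , uv , v∉X , v≁X)
  ... | yes (v , uv , v∉X , v≁X) = inj₂ (X ∪ ⁅ v ⁆ , p⊆p∪q _ , grows , within , stable-∪ sX (stable-⁅⁆ v) X≁v)
    where
      grows : ∣ X ∣ < ∣ X ∪ ⁅ v ⁆ ∣
      grows = p⊂q⇒∣p∣<∣q∣ (p⊆p∪q _ , v , q⊆p∪q X _ (x∈⁅x⁆ v) , v∉X)
      within : ∀ {w} → w ∈ X ∪ ⁅ v ⁆ → U w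
      within {w} w∈X⁺ = [ X⊆U , (λ w∈v → subst U (sym (x∈⁅y⁆⇒x≡y v w∈v)) uv) ] (x∈p∪q⁻ X _ w∈X⁺)
      X≁v : NoEdges X ⁅ v ⁆
      X≁v x y x∈X y∈v x~y with x∈⁅y⁆⇒x≡y v y∈v
      ... | refl = v≁X (x , x∈X , adj-sym x~y)

  abstract
    extend : {U : Fin n → Set} → Decidable U → (X : Subset n) → (∀ {v} → v ∈ X → U v) → Stable G X →
             ∃ λ P → X ⊆ P × MaximalIn U P
    extend {U} U? X = grow n X (m≤m+n n ∣ X ∣)
      where
        -- k bounds the number of vertices that can still be added to X.
        grow : (k : ℕ) (X : Subset n) → n ≤ k + ∣ X ∣ → (∀ {v} → v ∈ X → U v) → Stable G X → ∃ λ P → X ⊆ P × MaximalIn U P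
        grow k X bound X⊆U sX with maximal-or-grow U? X X⊆U sX
        ... | inj₁ maximal = X , (λ x∈X → x∈X) , maximal
        ... | inj₂ (X⁺ , X⊆X⁺ , grows , X⁺⊆U , sX⁺) with k
        ...   | zero  = contradiction (∣p∣≤n X⁺) (<⇒≱ (≤-<-trans bound grows))
        ...   | suc k with grow k X⁺ (≤-trans bound (≤-trans (≤-reflexive (sym (+-suc k ∣ X ∣))) (+-monoʳ-≤ k grows))) X⁺⊆U sX⁺
        ...     | P , X⁺⊆P , maximal = P , X⁺⊆P ∘ X⊆X⁺ , maximal

  maximal-stable-in : {U : Fin n → Set} → Decidable U → ∃ (MaximalIn U)
  maximal-stable-in U? with extend U? ⊥ (⊥-elim ∘ ∉⊥) stable-⊥
  ... | P , _ , P-maximal = P , P-maximal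

  well-covered-bound : WellCovered G → {M Z : Subset n} → MaximalStable G M → Stable G Z → ∣ Z ∣ ≤ ∣ M ∣
  well-covered-bound wc {M} {Z} M-maximal sZ with extend (_∈? ⊤) Z (λ _ → ∈⊤) sZ
  ... | P , Z⊆P , P-maximal = ≤-trans (p⊆q⇒∣p∣≤∣q∣ Z⊆P) (≤-reflexive (wc P M P-maximalStable M-maximal))
    where
      open MaximalIn P-maximal
      P-maximalStable : MaximalStable G P
      P-maximalStable = stable , λ v v∉P → dominating ∈⊤ v∉P

  exchange : WellCovered G → {C D E : Subset n} → Disjoint C D → Stable G (C ∪ D) → MaximalStable G (C ∪ E) → ∣ D ∣ ≤ ∣ E ∣
  exchange wc {C} {D} {E} C#D sC∪D C∪E-maximal = +-cancelˡ-≤ ∣ C ∣ _ _ (begin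
    ∣ C ∣ + ∣ D ∣  ≡⟨ disjoint⇒∣p∪q∣≡∣p∣+∣q∣ C#D ⟨
    ∣ C ∪ D ∣      ≤⟨ well-covered-bound wc C∪E-maximal sC∪D ⟩
    ∣ C ∪ E ∣      ≤⟨ ∣p∪q∣≤∣p∣+∣q∣ C E ⟩
    ∣ C ∣ + ∣ E ∣  ∎)
    where open ≤-Reasoning

  IsOuter : Subset n → Subset n → Fin n → Set
  IsOuter A D v = Undominated A v × v ∉ D × AdjTo D v

  isOuter? : (A D : Subset n) → Decidable (IsOuter A D)
  isOuter? A D v = undominated? A v ×-dec (¬? (v ∈? D) ×-dec adjTo? D v)

  OuterNbhd : Subset n → Subset n → Subset n
  OuterNbhd A D = ⟦ isOuter? A D ⟧

  Untouched : Subset n → Subset n → Subset n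
  Untouched Y D = ⟦ (λ v → (v ∈? D) ×-dec ¬? (adjTo? Y v)) ⟧

  untouched-⊆ : {Y D : Subset n} → Untouched Y D ⊆ D
  untouched-⊆ = proj₁ ∘ ∈⟦⟧⁻

  untouched-noEdges : {Y D : Subset n} → NoEdges Y (Untouched Y D)
  untouched-noEdges x y x∈Y y∈D′ x~y = proj₂ (∈⟦⟧⁻ y∈D′) (x , x∈Y , adj-sym x~y)

  untouched-⊂ : {Y D : Subset n} {d y : Fin n} → d ∈ D → y ∈ Y → Adj d y → Untouched Y D ⊂ D
  untouched-⊂ {d = d} {y} d∈D y∈Y d~y = untouched-⊆ , d , d∈D , λ d∈D′ → untouched-noEdges y d y∈Y d∈D′ (adj-sym d~y)

  outer-split : {A D Y : Subset n} → Stable G D → (∀ {v} → v ∈ Y → IsOuter A D v) →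
                ∣ Y ∣ + ∣ OuterNbhd A (Untouched Y D) ∣ ≤ ∣ OuterNbhd A D ∣
  outer-split {A} {D} {Y} sD Y-outer = disjoint⇒∣p∣+∣q∣≤∣r∣ Y#O′ (∈⟦⟧⁺ ∘ Y-outer) O′⊆O
    where
      Y#O′ : Disjoint Y (OuterNbhd A (Untouched Y D))
      Y#O′ v∈Y v∈O′ with ∈⟦⟧⁻ v∈O′
      ... | _ , _ , d , d∈D′ , v~d = untouched-noEdges _ d v∈Y d∈D′ v~d
      O′⊆O : OuterNbhd A (Untouched Y D) ⊆ OuterNbhd A D
      O′⊆O {v} v∈O′ with ∈⟦⟧⁻ v∈O′
      ... | v∉N[A] , _ , d , d∈D′ , v~d =
        ∈⟦⟧⁺ (v∉N[A] , (λ v∈D → sD v d v∈D (untouched-⊆ d∈D′) v~d) , d , untouched-⊆ d∈D′ , v~d)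

  record Augmentation (A D : Subset n) (y : Fin n) : Set where
    field
      Y        : Subset n
      stable   : Stable G Y
      outer    : ∀ {v} → v ∈ Y → IsOuter A D v
      contains : y ∈ Y
      bound    : ∣ D ∣ ≤ ∣ Y ∣ + ∣ Untouched Y D ∣

  -- Take R maximal stable outside
  -- N[A] ∪ N[D] ∪ N(y), then Y ∋ y maximal stable in N(D) − N[A] − N(R), and D′ = Untouched Y D.
  -- Then A ∪ R ∪ Y ∪ D′ is a maximal stable set while A ∪ R ∪ D is stable, so by the
  -- exchange lemma |D| ≤ |Y ∪ D′|.
  module Augment (wc : WellCovered G) {A D : Subset n} (sA : Stable G A) (sD : Stable G D)
                 (D-undominated : ∀ {d} → d ∈ D → Undominated A d) {y : Fin n} (y-outer : IsOuter A D y) where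

    Remote : Fin n → Set
    Remote v = Undominated A v × Undominated D v × ¬ Adj v y

    R-max : ∃ (MaximalIn Remote)
    R-max = maximal-stable-in λ v → undominated? A v ×-dec undominated? D v ×-dec ¬? (adj? v y)

    R : Subset n
    R = proj₁ R-max
    open MaximalIn (proj₂ R-max) renaming (within to R⊆Remote; stable to sR; dominating to R-dominating)

    Near : Fin n → Set
    Near v = IsOuter A D v × ¬ AdjTo R v

    y-near : Near y
    y-near = y-outer , λ (r , r∈R , y~r) → proj₂ (proj₂ (R⊆Remote r∈R)) (adj-sym y~r)

    Y-ext : ∃ λ Y → ⁅ y ⁆ ⊆ Y × MaximalIn Near Y
    Y-ext = extend (λ v → isOuter? A D v ×-dec ¬? (adjTo? R v))
                   ⁅ y ⁆ (λ v∈y → subst Near (sym (x∈⁅y⁆⇒x≡y y v∈y)) y-near) (stable-⁅⁆ y)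

    Y : Subset n
    Y = proj₁ Y-ext
    open MaximalIn (proj₂ (proj₂ Y-ext)) renaming (within to Y⊆Near; stable to sY; dominating to Y-dominating)

    D′ : Subset n
    D′ = Untouched Y D
    C : Subset n
    C = A ∪ R
    M : Subset n
    M = C ∪ (Y ∪ D′)

    A≁R : NoEdges A R
    A≁R = undominated-noEdges (proj₁ ∘ R⊆Remote)
    A≁D : NoEdges A D
    A≁D = undominated-noEdges D-undominated
    A≁Y : NoEdges A Y
    A≁Y = undominated-noEdges (proj₁ ∘ proj₁ ∘ Y⊆Near)
    R≁D : NoEdges R D
    R≁D = noEdges-sym (undominated-noEdges (proj₁ ∘ proj₂ ∘ R⊆Remote))
    R≁Y : NoEdges R Y
    R≁Y r v r∈R v∈Y r~v = proj₂ (Y⊆Near v∈Y) (r , r∈R , adj-sym r~v)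

    sC : Stable G C
    sC = stable-∪ sA sR A≁R

    sC∪D : Stable G (C ∪ D)
    sC∪D = stable-∪ sC sD (noEdges-∪ˡ A≁D R≁D)

    sM : Stable G M
    sM = stable-∪ sC (stable-∪ sY (stable-⊆ untouched-⊆ sD) untouched-noEdges)
                     (noEdges-∪ˡ (noEdges-∪ʳ A≁Y (noEdges-⊆ʳ untouched-⊆ A≁D))
                                 (noEdges-∪ʳ R≁Y (noEdges-⊆ʳ untouched-⊆ R≁D)))

    A⊆M : A ⊆ M
    A⊆M = p⊆p∪q _ ∘ p⊆p∪q R
    R⊆M : R ⊆ M
    R⊆M = p⊆p∪q _ ∘ q⊆p∪q A R
    Y⊆M : Y ⊆ M
    Y⊆M = q⊆p∪q C _ ∘ p⊆p∪q D′
    D′⊆M : D′ ⊆ M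
    D′⊆M = q⊆p∪q C _ ∘ q⊆p∪q Y D′

    y∈Y : y ∈ Y
    y∈Y = proj₁ (proj₂ Y-ext) (x∈⁅x⁆ y)

    -- M is a maximal stable set: a vertex z ∉ M sees A, or lies in D (and then sees Y, as
    -- z ∉ D′), or lies in N(D) (and then sees R or Y, by maximality of Y), or sees neither D
    -- nor A (and then sees y or R, by maximality of R).
    seen-in-D : ∀ {z} → z ∉ M → z ∈ D → AdjTo M z
    seen-in-D {z} z∉M z∈D = adjTo-mono Y⊆M (decidable-stable (adjTo? Y z) λ z≁Y → z∉M (D′⊆M (∈⟦⟧⁺ (z∈D , z≁Y))))

    seen-near-D : ∀ {z} → z ∉ M → ¬ AdjTo A z → z ∉ D → AdjTo D z → AdjTo M z
    seen-near-D {z} z∉M z≁A z∉D z~D =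
      [ adjTo-mono R⊆M , (λ z≁R → adjTo-mono Y⊆M (Y-dominating (((z∉M ∘ A⊆M , z≁A) , z∉D , z~D) , z≁R) (z∉M ∘ Y⊆M))) ]′
      (toSum (adjTo? R z))

    seen-far-from-D : ∀ {z} → z ∉ M → ¬ AdjTo A z → z ∉ D → ¬ AdjTo D z → AdjTo M z
    seen-far-from-D {z} z∉M z≁A z∉D z≁D =
      [ (λ z~y → y , Y⊆M y∈Y , z~y) , (λ z≁y → adjTo-mono R⊆M (R-dominating ((z∉M ∘ A⊆M , z≁A) , (z∉D , z≁D) , z≁y) (z∉M ∘ R⊆M))) ]′
      (toSum (adj? z y))

    M-dominating : ∀ z → z ∉ M → AdjTo M z
    M-dominating z z∉M =
      [ adjTo-mono A⊆M , (λ z≁A →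
      [ seen-in-D z∉M , (λ z∉D →
      [ seen-near-D z∉M z≁A z∉D , seen-far-from-D z∉M z≁A z∉D ]′ (toSum (adjTo? D z))) ]′ (toSum (z ∈? D))) ]′ (toSum (adjTo? A z))

    C#D : Disjoint C D
    C#D {x} x∈C x∈D = [ (λ x∈A → proj₁ (D-undominated x∈D) x∈A) , (λ x∈R → proj₁ (proj₁ (proj₂ (R⊆Remote x∈R))) x∈D) ]
                        (x∈p∪q⁻ A R x∈C)

    augmentation : Augmentation A D y
    augmentation = record
      { Y        = Y
      ; stable   = sY
      ; outer    = proj₁ ∘ Y⊆Near
      ; contains = y∈Y
      ; bound    = ≤-trans (exchange wc C#D sC∪D (sM , M-dominating)) (∣p∪q∣≤∣p∣+∣q∣ Y D′)
      }

  abstract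
    augment : WellCovered G → {A D : Subset n} → Stable G A → Stable G D → (∀ {d} → d ∈ D → Undominated A d) →
              {y : Fin n} → IsOuter A D y → Augmentation A D y
    augment wc sA sD D-undominated y-outer = Augment.augmentation wc sA sD D-undominated y-outer

  Escapes : Subset n → Subset n → Set
  Escapes S Q = ∀ {q} → q ∈ Q → Undominated S q × ∃ λ u → Adj q u × Undominated S u

  -- By induction along ⊂:
  -- augmenting Q at a neighbour u of some q ∈ Q gives |Q| ≤ |Y| + |Q′| with Q′ ⊂ Q.
  hall : WellCovered G → {S : Subset n} → Stable G S → (Q : Subset n) → Stable G Q → Escapes S Q →
         ∣ Q ∣ ≤ ∣ OuterNbhd S Q ∣
  hall wc {S} sS Q = go Q (⊂-wellFounded Q)
    where
      go : (Q : Subset n) → Acc _⊂_ Q → Stable G Q → Escapes S Q → ∣ Q ∣ ≤ ∣ OuterNbhd S Q ∣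
      go Q (acc smaller) sQ escapes with nonempty? Q
      ... | no empty = ≤-trans (≤-reflexive (trans (cong ∣_∣ (Empty-unique empty)) (∣⊥∣≡0 n))) z≤n
      ... | yes (q , q∈Q) with escapes q∈Q
      ...   | _ , u , q~u , u∉N[S] = begin
        ∣ Q ∣                               ≤⟨ bound ⟩
        ∣ Y ∣ + ∣ Q′ ∣                      ≤⟨ +-monoʳ-≤ ∣ Y ∣ (go Q′ (smaller Q′⊂Q) (stable-⊆ untouched-⊆ sQ) (escapes ∘ untouched-⊆)) ⟩
        ∣ Y ∣ + ∣ OuterNbhd S Q′ ∣          ≤⟨ outer-split sQ outer ⟩
        ∣ OuterNbhd S Q ∣                   ∎
        where
          open ≤-Reasoning
          u-outer : IsOuter S Q u
          u-outer = u∉N[S] , (λ u∈Q → sQ q u q∈Q u∈Q q~u) , q , q∈Q , adj-sym q~u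
          open Augmentation (augment wc sS sQ (proj₁ ∘ escapes) u-outer)
          Q′ : Subset n
          Q′ = Untouched Y Q
          Q′⊂Q : Q′ ⊂ Q
          Q′⊂Q = untouched-⊂ q∈Q contains q~u

  -- A vertex h outside N[S] all of whose neighbours lie in N[S] (a "trapped" vertex) with some
  -- neighbour a: augmenting D = S ∪ {h} at a gives a stable set Y ∪ D′ ⊆ N[S] with
  -- |S| + 1 = |D| ≤ |Y ∪ D′|, since Y ⊆ N(D) ⊆ N(S) and a ∈ Y touches h, so D′ ⊆ S.
  module Trapped (wc : WellCovered G) {S : Subset n} (sS : Stable G S) {h a : Fin n}
                 (h∉N[S] : Undominated S h) (h~a : Adj h a) (trapped : ∀ {v} → Adj h v → AdjTo S v) where

    D : Subset n
    D = S ∪ ⁅ h ⁆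

    h∈D : h ∈ D
    h∈D = q⊆p∪q S _ (x∈⁅x⁆ h)

    S#h : Disjoint S ⁅ h ⁆
    S#h x∈S x∈h = proj₁ h∉N[S] (subst (_∈ S) (x∈⁅y⁆⇒x≡y h x∈h) x∈S)

    sD : Stable G D
    sD = stable-∪ sS (stable-⁅⁆ h) (undominated-noEdges λ x∈h → subst (Undominated S) (sym (x∈⁅y⁆⇒x≡y h x∈h)) h∉N[S])

    a∉D : a ∉ D
    a∉D a∈D = [ (λ a∈S → proj₂ h∉N[S] (a , a∈S , h~a)) , (λ a∈h → irrefl (subst (Adj h) (x∈⁅y⁆⇒x≡y h a∈h) h~a)) ]′
              (x∈p∪q⁻ S _ a∈D)

    open Augmentation (augment wc stable-⊥ sD (λ {d} _ → undominated-⊥ d) (undominated-⊥ a , a∉D , h , h∈D , adj-sym h~a))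

    D′ : Subset n
    D′ = Untouched Y D
    T : Subset n
    T = Y ∪ D′

    Y⊆N[S] : Y ⊆ ClosedNbhd G S
    Y⊆N[S] {v} v∈Y with outer v∈Y
    ... | _ , v∉D , d , d∈D , v~d = q⊆p∪q S _ (∈Nbhd⁺ (v∉D ∘ p⊆p∪q _) ([ (λ d∈S → d , d∈S , v~d) , via-h ]′ (x∈p∪q⁻ S _ d∈D)))
      where
        via-h : d ∈ ⁅ h ⁆ → AdjTo S v
        via-h d∈h = trapped (adj-sym (subst (Adj v) (x∈⁅y⁆⇒x≡y h d∈h) v~d))

    D′⊆N[S] : D′ ⊆ ClosedNbhd G S
    D′⊆N[S] {d} d∈D′ = p⊆p∪q _ ([ (λ d∈S → d∈S) , (λ d∈h → ⊥-elim (h∉D′ (subst (_∈ D′) (x∈⁅y⁆⇒x≡y h d∈h) d∈D′))) ]′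
                                  (x∈p∪q⁻ S _ (untouched-⊆ d∈D′)))
      where
        h∉D′ : h ∉ D′
        h∉D′ h∈D′ = untouched-noEdges a h contains h∈D′ (adj-sym h~a)

    S<T : ∣ S ∣ < ∣ T ∣
    S<T = begin-strict
      ∣ S ∣                ≡⟨ +-identityʳ ∣ S ∣ ⟨
      ∣ S ∣ + 0            <⟨ +-monoʳ-< ∣ S ∣ (≤-reflexive (sym (∣⁅x⁆∣≡1 h))) ⟩
      ∣ S ∣ + ∣ ⁅ h ⁆ ∣    ≡⟨ disjoint⇒∣p∪q∣≡∣p∣+∣q∣ S#h ⟨
      ∣ D ∣                ≤⟨ bound ⟩
      ∣ Y ∣ + ∣ D′ ∣       ≡⟨ disjoint⇒∣p∪q∣≡∣p∣+∣q∣ (λ v∈Y v∈D′ → proj₁ (proj₂ (outer v∈Y)) (untouched-⊆ v∈D′)) ⟨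
      ∣ T ∣                ∎
      where open ≤-Reasoning

    larger-stable-set : ∃ λ T → T ⊆ ClosedNbhd G S × Stable G T × ∣ S ∣ < ∣ T ∣
    larger-stable-set = T , (λ v∈T → [ Y⊆N[S] , D′⊆N[S] ]′ (x∈p∪q⁻ Y D′ v∈T))
                          , stable-∪ stable (stable-⊆ untouched-⊆ sD) untouched-noEdges , S<T

  -- For S ∈ Ψ(G) in a well-covered graph, a vertex h outside N[S] with a neighbour has a
  -- neighbour outside N[S]: otherwise h is trapped and N[S] holds a stable set larger than S.
  escape : WellCovered G → {S : Subset n} → LocalMaximumStable G S →
           {h a : Fin n} → Undominated S h → Adj h a → ∃ λ u → Adj h u × Undominated S u
  escape wc {S} (_ , sS , S-max) {h} h∉N[S] h~a with any? (λ u → adj? h u ×-dec undominated? S u)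
  ... | yes found = found
  ... | no none = ⊥-elim (not-larger (Trapped.larger-stable-set wc sS h∉N[S] h~a trapped))
    where
      trapped : ∀ {v} → Adj h v → AdjTo S v
      trapped {v} h~v = decidable-stable (adjTo? S v) λ v≁S → none (v , h~v , (λ v∈S → proj₂ h∉N[S] (v , v∈S , h~v)) , v≁S)
      not-larger : ¬ (∃ λ T → T ⊆ ClosedNbhd G S × Stable G T × ∣ S ∣ < ∣ T ∣)
      not-larger (T , T⊆N[S] , sT , S<T) = <⇒≱ S<T (S-max T T⊆N[S] sT)

  -- In a well-covered graph without isolated vertices every stable set B has |B| ≤ |N(B)|
  -- (Hall's condition outside N[∅]).
  nbhd-lower-bound : WellCovered G → NoIsolated G → {B : Subset n} → Stable G B → ∣ B ∣ ≤ ∣ Nbhd G B ∣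
  nbhd-lower-bound wc no-isolated {B} sB =
    ≤-trans (hall wc stable-⊥ B sB escapes) (p⊆q⇒∣p∣≤∣q∣ λ v∈O → let (_ , v∉B , v~B) = ∈⟦⟧⁻ v∈O in ∈Nbhd⁺ v∉B v~B)
    where
      escapes : Escapes ⊥ B
      escapes {b} _ = let (u , b~u) = no-isolated b in undominated-⊥ b , u , b~u , undominated-⊥ u

  ∪-maximal : {S Q : Subset n} → Stable G S → MaximalIn (Undominated S) Q → MaximalStable G (S ∪ Q)
  ∪-maximal {S} {Q} sS Q-maximal = stable-∪ sS stable (undominated-noEdges within) , dominating-S∪Q
    where
      open MaximalIn Q-maximal
      dominating-S∪Q : ∀ z → z ∉ S ∪ Q → AdjTo (S ∪ Q) z
      dominating-S∪Q z z∉S∪Q =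
        [ adjTo-mono (p⊆p∪q Q) ,
          (λ z≁S → adjTo-mono (q⊆p∪q S Q) (dominating (z∉S∪Q ∘ p⊆p∪q Q , z≁S) (z∉S∪Q ∘ q⊆p∪q S Q))) ]′
        (toSum (adjTo? S z))

  -- Extend S by a maximal stable
  -- set Q of G − N[S]: S ∪ Q is maximal, hence of size α(G) = n/2.  By `escape` Q satisfies
  -- Hall's condition outside N[S], so |Q| ≤ |O| for O = N(Q) − N[S]; as S ∪ Q, N(S) and O are
  -- disjoint, |S| + |Q| + |N(S)| + |Q| ≤ n = 2(|S| + |Q|).
  nbhd-upper-bound : VeryWellCovered G → {S : Subset n} → LocalMaximumStable G S → ∣ Nbhd G S ∣ ≤ ∣ S ∣
  nbhd-upper-bound (wc , no-isolated , S₀ , (sS₀ , S₀-maximum) , n≡2∣S₀∣) {S} S∈Ψ@(_ , sS , _) =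
    half-bound count (≤-reflexive (disjoint⇒∣p∪q∣≡∣p∣+∣q∣ S#Q)) (hall wc sS Q stable escapes)
    where
      Q : Subset n
      Q = proj₁ (maximal-stable-in (undominated? S))
      Q-maximal : MaximalIn (Undominated S) Q
      Q-maximal = proj₂ (maximal-stable-in (undominated? S))
      open MaximalIn Q-maximal
      P : Subset n
      P = S ∪ Q
      N : Subset n
      N = Nbhd G S
      O : Subset n
      O = OuterNbhd S Q

      escapes : Escapes S Q
      escapes {q} q∈Q = within q∈Q , escape wc S∈Ψ (within q∈Q) (proj₂ (no-isolated q))

      S#Q : Disjoint S Q
      S#Q x∈S x∈Q = proj₁ (within x∈Q) x∈S

      P#N∪O : Disjoint P (N ∪ O)
      P#N∪O {x} x∈P x∈N∪O = [ in-S , in-Q ]′ (x∈p∪q⁻ S Q x∈P)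
        where
          in-S : x ∉ S
          in-S x∈S = [ (λ x∈N → proj₁ (∈Nbhd⁻ x∈N) x∈S) , (λ x∈O → proj₁ (proj₁ (∈⟦⟧⁻ x∈O)) x∈S) ]′ (x∈p∪q⁻ N O x∈N∪O)
          in-Q : x ∉ Q
          in-Q x∈Q = [ (λ x∈N → proj₂ (within x∈Q) (proj₂ (∈Nbhd⁻ x∈N))) , (λ x∈O → proj₁ (proj₂ (∈⟦⟧⁻ x∈O)) x∈Q) ]′
                       (x∈p∪q⁻ N O x∈N∪O)

      N#O : Disjoint N O
      N#O x∈N x∈O = proj₂ (proj₁ (∈⟦⟧⁻ x∈O)) (proj₂ (∈Nbhd⁻ x∈N))

      ∣P∣≡∣S₀∣ : ∣ P ∣ ≡ ∣ S₀ ∣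
      ∣P∣≡∣S₀∣ = ≤-antisym (S₀-maximum P (proj₁ (∪-maximal sS Q-maximal))) (well-covered-bound wc (∪-maximal sS Q-maximal) sS₀)

      count : ∣ P ∣ + (∣ N ∣ + ∣ O ∣) ≤ 2 * ∣ P ∣
      count = begin
        ∣ P ∣ + (∣ N ∣ + ∣ O ∣)  ≡⟨ cong (∣ P ∣ +_) (disjoint⇒∣p∪q∣≡∣p∣+∣q∣ N#O) ⟨
        ∣ P ∣ + ∣ N ∪ O ∣        ≤⟨ disjoint⇒∣p∣+∣q∣≤∣r∣ P#N∪O (⊆⊤ {n}) (⊆⊤ {n}) ⟩
        ∣ ⊤ {n} ∣                ≡⟨ ∣⊤∣≡n n ⟩
        n                        ≡⟨ n≡2∣S₀∣ ⟩
        2 * ∣ S₀ ∣               ≡⟨ cong (2 *_) ∣P∣≡∣S₀∣ ⟨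
        2 * ∣ P ∣                ∎
        where open ≤-Reasoning

  -- In a well-covered graph without isolated vertices, a stable S with |S| = |N(S)| lies in Ψ(G):
  -- a stable T ⊆ N[S] splits into B = T ∩ S and C = T ∩ N(S), and N(B) ⊆ N(S) is disjoint
  -- from C, so |T| ≤ |B| + |C| ≤ |N(B)| + |C| ≤ |N(S)| = |S|.
  balanced⇒local-max : WellCovered G → NoIsolated G → {S : Subset n} → Stable G S →
                       ∣ S ∣ ≡ ∣ Nbhd G S ∣ → LocalMaximumStable G S
  balanced⇒local-max wc no-isolated {S} sS ∣S∣≡∣N∣ = p⊆p∪q _ , sS , bound
    where
      bound : ∀ T → T ⊆ ClosedNbhd G S → Stable G T → ∣ T ∣ ≤ ∣ S ∣
      bound T T⊆N[S] sT = begin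
        ∣ T ∣                 ≤⟨ p⊆q⇒∣p∣≤∣q∣ T⊆B∪C ⟩
        ∣ B ∪ C ∣             ≤⟨ ∣p∪q∣≤∣p∣+∣q∣ B C ⟩
        ∣ B ∣ + ∣ C ∣         ≤⟨ +-monoˡ-≤ ∣ C ∣ (nbhd-lower-bound wc no-isolated (stable-⊆ (p∩q⊆q T S) sS)) ⟩
        ∣ Nbhd G B ∣ + ∣ C ∣  ≤⟨ disjoint⇒∣p∣+∣q∣≤∣r∣ NB#C NB⊆NS (p∩q⊆q T _) ⟩
        ∣ Nbhd G S ∣          ≡⟨ ∣S∣≡∣N∣ ⟨
        ∣ S ∣                 ∎
        where
          open ≤-Reasoning
          B : Subset n
          B = T ∩ S
          C : Subset n
          C = T ∩ Nbhd G S

          T⊆B∪C : T ⊆ B ∪ C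
          T⊆B∪C x∈T = [ (λ x∈S → p⊆p∪q C (x∈p∩q⁺ (x∈T , x∈S))) , (λ x∈N → q⊆p∪q B C (x∈p∩q⁺ (x∈T , x∈N))) ]′
                        (x∈p∪q⁻ S _ (T⊆N[S] x∈T))

          NB#C : Disjoint (Nbhd G B) C
          NB#C {x} x∈NB x∈C with ∈Nbhd⁻ x∈NB
          ... | _ , b , b∈B , x~b = sT x b (p∩q⊆p T _ x∈C) (p∩q⊆p T S b∈B) x~b

          NB⊆NS : Nbhd G B ⊆ Nbhd G S
          NB⊆NS {x} x∈NB with ∈Nbhd⁻ x∈NB
          ... | _ , b , b∈B , x~b = ∈Nbhd⁺ (λ x∈S → sS x b x∈S (p∩q⊆q T S b∈B) x~b) (b , p∩q⊆q T S b∈B , x~b)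

lemma1 : {n : ℕ} (G : Graph n) → VeryWellCovered G → (S : Subset n) → Stable G S →
         (LocalMaximumStable G S ⇔ (∣ S ∣ ≡ ∣ Nbhd G S ∣))
lemma1 G vwc@(wc , no-isolated , _) S sS = mk⇔
  (λ S∈Ψ → ≤-antisym (nbhd-lower-bound G wc no-isolated sS) (nbhd-upper-bound G vwc S∈Ψ))
  (balanced⇒local-max G wc no-isolated sS)
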